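{- Let $k,\ell$ be non-negative odd integers with $\ell > k$. For all integers $n \geq 2$, the $n$-th Fourier coefficient (coefficient of $q^n$) of \[ g_{k,\ell} := (D^{3\ell} + D^{2\ell} + D^{\ell} + 1)G_{3k+1} - (D^{3k} + D^{2k} + D^k + 1)G_{3\ell + 1} \] vanishes if and only if $n = p^3$ for some prime $p$.
   Context: For an even integer $k\ge2$, let $B_k$ be the $k$-th Bernoulli number and define the Eisenstein series $G_k(\tau) := -\frac{B_k}{2k} + \sum_{n\ge1}\sigma_{k-1}(n)q^n$, where $q=e^{2\pi i\tau}$, $\tau$ in the upper half-plane, and $\sigma_{k-1}(n)=\sum_{d\mid n}d^{k-1}$. Let $D := \frac{1}{2\pi i}\frac{d}{d\tau} = q\frac{d}{dq}$, so $D^j q^n = n^j q^n$; $D^0$ is the identity. -}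

module Defs where

open import Data.Nat as ℕ using (ℕ; zero; suc; _^_)
import Data.Nat.ListAction
open import Data.Nat.Combinatorics using (_C_)
open import Data.Nat.Divisibility using (_∣?_)
open import Data.Integer using (+_)
open import Data.Rational using (ℚ; 0ℚ; 1ℚ; _+_; _*_; -_; _/_)
open import Data.List using (List; []; _∷_; _++_; [_]; zipWith; upTo; reverse; filter; map; foldr)
open import Data.Product using (∃)
open import Relation.Binary.PropositionalEquality using (_≡_)

ℕ→ℚ : ℕ → ℚ
ℕ→ℚ n = + n / 1

Σℚ : List ℚ → ℚ
Σℚ = foldr _+_ 0ℚ

-- Bernoulli numbers B_0, …, B_m  (convention B_1 = -1/2), via
-- B_0 = 1,  B_m = -(1/(m+1)) Σ_{j<m} C(m+1,j) B_j
bernoullis : ℕ → List ℚ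
bernoullis zero = 1ℚ ∷ []
bernoullis (suc m) = bs ++ [ - (((+ 1) / (suc (suc m))) * Σℚ (zipWith (λ j b → ℕ→ℚ (suc (suc m) C j) * b) (upTo (suc m)) bs)) ]
  where bs = bernoullis m

lastOr : List ℚ → ℚ
lastOr xs with reverse xs
... | [] = 0ℚ
... | x ∷ _ = x

bernoulli : ℕ → ℚ
bernoulli m = lastOr (bernoullis m)

σ : ℕ → ℕ → ℕ
σ s n = Data.Nat.ListAction.sum (map (λ d → d ^ s) (filter (_∣? n) (upTo (suc n))))

-- q-series, represented by their Fourier coefficients (coefficient of q^n)
Series : Set
Series = ℕ → ℚ

-- Eisenstein series G_k = -B_k/(2k) + Σ_{n≥1} σ_{k-1}(n) q^n  (k ≥ 2 even in use)
G : ℕ → Series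
G zero _ = 0ℚ
G (suc k) zero = - (bernoulli (suc k) * ((+ 1) / (suc k ℕ.+ suc k)))
G (suc k) (suc n) = ℕ→ℚ (σ k (suc n))

-- D = q d/dq acts by D^j q^n = n^j q^n
Dpow : ℕ → Series → Series
Dpow j f n = ℕ→ℚ (n ^ j) * f n

_⊕_ : Series → Series → Series
(f ⊕ g) n = f n + g n

_⊖_ : Series → Series → Series
(f ⊖ g) n = f n + - (g n)

P : ℕ → Series → Series
P a f = Dpow (3 ℕ.* a) f ⊕ (Dpow (2 ℕ.* a) f ⊕ (Dpow a f ⊕ f))

g : ℕ → ℕ → Series
g k ℓ = P ℓ (G (3 ℕ.* k ℕ.+ 1)) ⊖ P k (G (3 ℕ.* ℓ ℕ.+ 1))

Odd : ℕ → Set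
Odd n = ∃ λ m → n ≡ suc (2 ℕ.* m)

-- The n-th coefficient of g_{k,ℓ} is φ(n^ℓ) σ_{3k}(n) − φ(n^k) σ_{3ℓ}(n) with φ(x) = 1 + x + x² + x³, so it
-- vanishes iff σ_{3e}(n)/φ(n^e) takes the same value at e = k and e = ℓ. For n = p³ the cubes of the divisors
-- of n are 1, n, n², n³, hence σ_{3e}(n) = φ(n^e) for every e. Otherwise let p be the least prime factor of n.
-- The terms 1 and n^{3e} of σ_{3e}(n) cancel against those of φ(n^e), and the comparison is decided by the
-- cubes of the divisors p and n/p against the middle terms n^e + n^{2e}. If p³ < n they exceed them, by an
-- amount that decays relative to φ(n^e) as e grows, and every other divisor d (with 2d ≤ n) pushes in the
-- same direction. If p³ > n then n is a prime, a prime square or a product of two primes, and the divisors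
-- fall short of the middle terms by a relative deficit that decays likewise. The decay estimates need
-- ℓ ≥ k + 2, which is where the oddness of k and ℓ enters.

module Submission where

open import Defs
open import Data.Nat using (ℕ; zero; suc; _+_; _*_; _^_; _∸_; _≤_; _<_; _≤?_; _≡ᵇ_; z≤n; s≤s; NonZero; >-nonZero;
  n>1⇒nonTrivial; nonTrivial⇒n>1)
open import Data.Nat.Properties
open import Data.Nat.Tactic.RingSolver using (solve-∀)
open import Data.Nat.Divisibility
open import Data.Nat.Coprimality using (Coprime; coprime-divisor)
open import Data.Nat.Primality using (Prime; prime⇒irreducible; prime⇒nonZero; prime⇒nonTrivial; _Rough_; 2-rough;
  ∤⇒rough-suc; rough⇒≤; rough∧∣⇒rough; rough∧∣⇒prime; rough∧square>⇒prime)
open import Data.Nat.ListAction using (sum)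
open import Data.Nat.ListAction.Properties using (sum-++)
import Data.Integer as ℤ
import Data.Integer.Properties as ℤ
open import Data.Rational as ℚ using (0ℚ; toℚᵘ)
import Data.Rational.Properties as ℚ
import Data.Rational.Unnormalised as ℚᵘ
import Data.Rational.Unnormalised.Properties as ℚᵘ
open import Algebra.Properties.Group ℚ.+-0-group using (x∙y⁻¹≈ε⇒x≈y; x≈y⇒x∙y⁻¹≈ε)
open import Data.Bool using (true; false; if_then_else_; T)
open import Data.List using (List; []; _∷_; [_]; _++_; map; filter; applyUpTo; upTo)
open import Data.List.Properties using (map-++)
open import Data.List.Membership.Propositional using (_∈_; _∉_)
open import Data.List.Relation.Unary.Any using (here; there)
open import Data.List.Relation.Unary.All as All using (All; []; _∷_)
open import Data.List.Relation.Unary.AllPairs as AllPairs using (AllPairs; []; _∷_)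
open import Data.List.Relation.Unary.Linked using (Linked; []; [-]; _∷_)
open import Data.List.Relation.Unary.Linked.Properties using (Linked⇒AllPairs)
open import Data.Product using (_,_; _×_; ∃)
open import Data.Sum using (_⊎_; inj₁; inj₂)
open import Function using (_∘_)
open import Function.Bundles using (_⇔_; mk⇔)
open import Function.Construct.Composition using (_⇔-∘_)
open import Relation.Nullary using (does; yes; no; ¬_; contradiction)
open import Relation.Nullary.Decidable using (dec-true; dec-false)
open import Relation.Binary.Definitions using (tri<; tri≈; tri>)
open import Relation.Binary.PropositionalEquality hiding ([_])

≤-by : ∀ {m n} r → m + r ≡ n → m ≤ n
≤-by {m} r refl = m≤m+n m r

<-by : ∀ {m n} r → 0 < r → m + r ≡ n → m < n
<-by {m} r 0<r refl = m<m+n m 0<r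

m+p≤n+o⇒m∸n≤o∸p : ∀ {m n o p} → m + p ≤ n + o → m ∸ n ≤ o ∸ p
m+p≤n+o⇒m∸n≤o∸p {m} {n} {o} {p} h = begin
  m ∸ n             ≡⟨ [m+n]∸[m+o]≡n∸o p m n ⟨
  (p + m) ∸ (p + n) ≤⟨ ∸-monoˡ-≤ (p + n) (≤-trans (≤-reflexive (+-comm p m)) h) ⟩
  (n + o) ∸ (p + n) ≡⟨ cong ((n + o) ∸_) (+-comm p n) ⟩
  (n + o) ∸ (n + p) ≡⟨ [m+n]∸[m+o]≡n∸o n o p ⟩
  o ∸ p             ∎
  where open ≤-Reasoning

2*m≤n⇒m≤n : ∀ {m n} → 2 * m ≤ n → m ≤ n
2*m≤n⇒m≤n {m} = ≤-trans (m≤m+n m (m + 0))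

double-cancel-< : ∀ {x X P Q} → X ≤ x → x + (x + P) < X + (X + Q) → x + P < X + Q
double-cancel-< {x} {X} {P} {Q} X≤x h = +-cancelˡ-< x (x + P) (X + Q) (<-≤-trans h (+-monoˡ-≤ (X + Q) X≤x))

*-self-cancel-≤ : ∀ {m n} → m * m ≤ n * n → m ≤ n
*-self-cancel-≤ {m} {n} h with m ≤? n
... | yes m≤n = m≤n
... | no m≰n = contradiction h (<⇒≱ (*-mono-< (≰⇒> m≰n) (≰⇒> m≰n)))

half-≤ : ∀ {b x} → 2 * b ≤ x → x ≤ 2 * (x ∸ b)
half-≤ {b} {x} 2b≤x = begin
  x                 ≡⟨ m∸n+n≡m (≤-trans (m≤m+n b b) b+b≤x) ⟨
  (x ∸ b) + b       ≤⟨ +-monoʳ-≤ (x ∸ b) (m+n≤o⇒m≤o∸n b b+b≤x) ⟩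
  (x ∸ b) + (x ∸ b) ≡⟨ cong ((x ∸ b) +_) (+-identityʳ (x ∸ b)) ⟨
  2 * (x ∸ b)       ∎
  where
  open ≤-Reasoning
  b+b≤x : b + b ≤ x
  b+b≤x = subst (λ z → b + z ≤ x) (+-identityʳ b) 2b≤x

square-double-≤ : ∀ {a b} → 4 ≤ a → b * b ≤ a * a * a → 2 * b ≤ a * a
square-double-≤ {a} {b} 4≤a h = *-self-cancel-≤ (begin
  2 * b * (2 * b) ≡⟨ e b ⟩
  4 * (b * b)     ≤⟨ *-monoʳ-≤ 4 h ⟩
  4 * (a * a * a) ≤⟨ *-monoˡ-≤ (a * a * a) 4≤a ⟩
  a * (a * a * a) ≡⟨ e′ a ⟩
  a * a * (a * a) ∎)
  where
  open ≤-Reasoning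
  e : ∀ b → 2 * b * (2 * b) ≡ 4 * (b * b)
  e = solve-∀
  e′ : ∀ a → a * (a * a * a) ≡ a * a * (a * a)
  e′ = solve-∀

^-distribʳ-* : ∀ m n k → (m * n) ^ k ≡ m ^ k * n ^ k
^-distribʳ-* m n zero = refl
^-distribʳ-* m n (suc k) = begin
  m * n * (m * n) ^ k     ≡⟨ cong (m * n *_) (^-distribʳ-* m n k) ⟩
  m * n * (m ^ k * n ^ k) ≡⟨ e m n (m ^ k) (n ^ k) ⟩
  m * m ^ k * (n * n ^ k) ∎
  where
  open ≡-Reasoning
  e : ∀ m n x y → m * n * (x * y) ≡ m * x * (n * y)
  e = solve-∀

m≤m^n : ∀ {m n} → 1 ≤ m → 1 ≤ n → m ≤ m ^ n
m≤m^n {m} {suc n} 1≤m _ = ≤-trans (≤-reflexive (sym (*-identityʳ m)))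
  (^-monoʳ-≤ m {{>-nonZero 1≤m}} (s≤s (z≤n {n})))

^-square : ∀ x e → x ^ (2 * e) ≡ x ^ e * x ^ e
^-square x e = trans (^-distribˡ-+-* x e (e + 0)) (cong (λ z → x ^ e * x ^ z) (+-identityʳ e))

^-cube : ∀ x e → x ^ (3 * e) ≡ x ^ e * x ^ e * x ^ e
^-cube x e = trans (^-distribˡ-+-* x e (2 * e)) (trans (cong (x ^ e *_) (^-square x e)) (sym (*-assoc (x ^ e) _ _)))

^-3≡ : ∀ p → p ^ 3 ≡ p * p * p
^-3≡ p = e p
  where
  e : ∀ p → p * (p * (p * 1)) ≡ p * p * p
  e = solve-∀

cube-power : ∀ d e → d ^ (3 * e) ≡ (d ^ 3) ^ e
cube-power d e = sym (^-*-assoc d 3 e)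

cube-product : ∀ {n p q} → n ≡ p * q → p ^ 3 * q ^ 3 ≡ n * n * n
cube-product {p = p} {q} refl = e p q
  where
  e : ∀ p q → p * (p * (p * 1)) * (q * (q * (q * 1))) ≡ p * q * (p * q) * (p * q)
  e = solve-∀

cube-product-^ : ∀ {u v n} e → u * v ≡ n * n * n → u ^ e * v ^ e ≡ n ^ e * n ^ e * n ^ e
cube-product-^ {u} {v} {n} e uv = begin
  u ^ e * v ^ e         ≡⟨ ^-distribʳ-* u v e ⟨
  (u * v) ^ e           ≡⟨ cong (_^ e) uv ⟩
  (n * n * n) ^ e       ≡⟨ ^-distribʳ-* (n * n) n e ⟩
  (n * n) ^ e * n ^ e   ≡⟨ cong (_* n ^ e) (^-distribʳ-* n n e) ⟩
  n ^ e * n ^ e * n ^ e ∎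
  where open ≡-Reasoning

rearrangement : ∀ {s t x X} → s ≤ t → x ≤ X → t * x + s * X ≤ s * x + t * X
rearrangement {s} {t} {x} {X} s≤t x≤X with m≤n⇒∃[o]m+o≡n s≤t | m≤n⇒∃[o]m+o≡n x≤X
... | d , refl | e , refl = ≤-by (d * e) (eq s d x e)
  where
  eq : ∀ s d x e → (s + d) * x + s * (x + e) + d * e ≡ s * x + (s + d) * (x + e)
  eq = solve-∀

mixed-term-≤ : ∀ {s t} k → s ≤ t → t * s ^ suc k + t * s ^ suc k ≤ s * s ^ suc k + t * t ^ suc k
mixed-term-≤ {s} {t} zero s≤t with m≤n⇒∃[o]m+o≡n s≤t
... | d , refl = ≤-by (d * d) (eq s d)
  where
  eq : ∀ s d → (s + d) * (s * 1) + (s + d) * (s * 1) + d * d ≡ s * (s * 1) + (s + d) * ((s + d) * 1)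
  eq = solve-∀
mixed-term-≤ {s} {t} (suc k) s≤t = begin
  t * (s * x) + t * (s * x) ≡⟨ e₁ s t x ⟨
  s * (t * x + t * x)       ≤⟨ *-monoʳ-≤ s (mixed-term-≤ k s≤t) ⟩
  s * (s * x + t * y)       ≡⟨ *-distribˡ-+ s (s * x) (t * y) ⟩
  s * (s * x) + s * (t * y) ≤⟨ +-monoʳ-≤ (s * (s * x)) (*-monoˡ-≤ (t * y) s≤t) ⟩
  s * (s * x) + t * (t * y) ∎
  where
  open ≤-Reasoning
  x = s ^ suc k
  y = t ^ suc k
  e₁ : ∀ s t x → s * (t * x + t * x) ≡ t * (s * x) + t * (s * x)
  e₁ = solve-∀

-- pow-gap with the subtractions moved across; the induction step rests on
-- t^{K+j+1} − s^{K+j+1} = t (t^{K+j} − s^{K+j}) + s^{K+j} (t − s).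
pow-gap-+ : ∀ {s t} k j → s ≤ t →
  t ^ j * t ^ suc k + suc j * (t ^ j * s ^ suc k) ≤ s ^ j * s ^ suc k + suc j * (t ^ j * t ^ suc k)
pow-gap-+ {s} {t} k zero s≤t = ≤-reflexive (e (t ^ suc k) (s ^ suc k))
  where
  e : ∀ x y → 1 * x + 1 * (1 * y) ≡ 1 * y + 1 * (1 * x)
  e = solve-∀
pow-gap-+ {s} {t} k (suc j) s≤t = +-cancelʳ-≤ E _ _ (begin
  t * tj * tK + (2 + j) * (t * tj * sK) + E
    ≡⟨ e₁ t tj tK sK sj s j ⟩
  t * (tj * tK + (1 + j) * (tj * sK)) + (t * (sj * sK) + s * (tj * sK)) + tj * (t * sK + t * sK)
    ≤⟨ +-mono-≤ (+-mono-≤ (*-monoʳ-≤ t (pow-gap-+ k j s≤t))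
                           (rearrangement s≤t (*-monoˡ-≤ sK (^-monoˡ-≤ j s≤t))))
                (*-monoʳ-≤ tj (mixed-term-≤ k s≤t)) ⟩
  t * (sj * sK + (1 + j) * (tj * tK)) + (s * (sj * sK) + t * (tj * sK)) + tj * (s * sK + t * tK)
    ≡⟨ e₂ t tj tK sK sj s j ⟩
  s * sj * sK + (2 + j) * (t * tj * tK) + E ∎)
  where
  open ≤-Reasoning
  tj = t ^ j
  sj = s ^ j
  tK = t ^ suc k
  sK = s ^ suc k
  E = t * tj * sK + t * (sj * sK) + s * (tj * sK)
  e₁ : ∀ t tj tK sK sj s j →
       t * tj * tK + (2 + j) * (t * tj * sK) + (t * tj * sK + t * (sj * sK) + s * (tj * sK))
       ≡ t * (tj * tK + (1 + j) * (tj * sK)) + (t * (sj * sK) + s * (tj * sK)) + tj * (t * sK + t * sK)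
  e₁ = solve-∀
  e₂ : ∀ t tj tK sK sj s j →
       t * (sj * sK + (1 + j) * (tj * tK)) + (s * (sj * sK) + t * (tj * sK)) + tj * (s * sK + t * tK)
       ≡ s * sj * sK + (2 + j) * (t * tj * tK) + (t * tj * sK + t * (sj * sK) + s * (tj * sK))
  e₂ = solve-∀

pow-gap : ∀ {s t k} j → 1 ≤ k → s ≤ t → t ^ (k + j) ∸ s ^ (k + j) ≤ suc j * t ^ j * (t ^ k ∸ s ^ k)
pow-gap {s} {t} {suc k} j _ s≤t = begin
  t ^ (suc k + j) ∸ s ^ (suc k + j)
    ≡⟨ cong₂ _∸_ (trans (^-distribˡ-+-* t (suc k) j) (*-comm (t ^ suc k) (t ^ j)))
                 (trans (^-distribˡ-+-* s (suc k) j) (*-comm (s ^ suc k) (s ^ j))) ⟩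
  t ^ j * t ^ suc k ∸ s ^ j * s ^ suc k
    ≤⟨ m+p≤n+o⇒m∸n≤o∸p {t ^ j * t ^ suc k} {s ^ j * s ^ suc k}
                         {suc j * (t ^ j * t ^ suc k)} {suc j * (t ^ j * s ^ suc k)} (pow-gap-+ k j s≤t) ⟩
  suc j * (t ^ j * t ^ suc k) ∸ suc j * (t ^ j * s ^ suc k)
    ≡⟨ *-distribˡ-∸ (suc j) (t ^ j * t ^ suc k) (t ^ j * s ^ suc k) ⟨
  suc j * (t ^ j * t ^ suc k ∸ t ^ j * s ^ suc k)
    ≡⟨ cong (suc j *_) (*-distribˡ-∸ (t ^ j) (t ^ suc k) (s ^ suc k)) ⟨
  suc j * (t ^ j * (t ^ suc k ∸ s ^ suc k))
    ≡⟨ *-assoc (suc j) (t ^ j) (t ^ suc k ∸ s ^ suc k) ⟨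
  suc j * t ^ j * (t ^ suc k ∸ s ^ suc k) ∎
  where open ≤-Reasoning

linear<exponential : ∀ {x j} → 4 ≤ x → 2 ≤ j → 30 * suc j < 8 * x ^ j
linear<exponential {x} {suc (suc i)} 4≤x (s≤s (s≤s z≤n)) = go i
  where
  go : ∀ i → 30 * (3 + i) < 8 * x ^ (2 + i)
  go zero = ≤-trans (≤-by 37 refl) (*-monoʳ-≤ 8 (*-mono-≤ 4≤x (*-mono-≤ 4≤x (s≤s z≤n))))
  go (suc i) = begin-strict
    30 * (4 + i)          ≤⟨ ≤-by (30 * (2 + i)) (e i) ⟩
    2 * (30 * (3 + i))    <⟨ *-monoʳ-< 2 (go i) ⟩
    2 * (8 * x ^ (2 + i)) ≤⟨ *-monoˡ-≤ (8 * x ^ (2 + i)) (≤-trans (s≤s (s≤s z≤n)) 4≤x) ⟩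
    x * (8 * x ^ (2 + i)) ≡⟨ x∙8y≡8∙xy x (x ^ (2 + i)) ⟩
    8 * x ^ (3 + i)       ∎
    where
    open ≤-Reasoning
    e : ∀ i → 30 * (4 + i) + 30 * (2 + i) ≡ 2 * (30 * (3 + i))
    e = solve-∀
    x∙8y≡8∙xy : ∀ x y → x * (8 * y) ≡ 8 * (x * y)
    x∙8y≡8∙xy = solve-∀

-- The polynomial φ and the comparison of exponents

-- φ (n ^ e) = 1 + n^e + n^{2e} + n^{3e} is the eigenvalue of D^{3e} + D^{2e} + D^e + 1 on q^n.
φ : ℕ → ℕ
φ a = a * a * a + (a * a + (a + 1))

φ-upper : ∀ {a} → 2 ≤ a → 8 * φ a ≤ 15 * (a * a * a)
φ-upper {a} 2≤a with m≤n⇒∃[o]m+o≡n 2≤a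
... | t , refl = ≤-by (44 * t + 34 * (t * t) + 7 * (t * t * t)) (e t)
  where
  e : ∀ t → 8 * ((2 + t) * (2 + t) * (2 + t) + ((2 + t) * (2 + t) + ((2 + t) + 1)))
              + (44 * t + 34 * (t * t) + 7 * (t * t * t))
            ≡ 15 * ((2 + t) * (2 + t) * (2 + t))
  e = solve-∀

φ-lower : ∀ a → a * a * a ≤ φ a
φ-lower a = m≤m+n (a * a * a) _

y[1+x²]<x[1+y²] : ∀ {x y} → 0 < x → x < y → y * (1 + x * x) < x * (1 + y * y)
y[1+x²]<x[1+y²] {suc x} _ x<y with m≤n⇒∃[o]m+o≡n x<y
... | d , refl = <-by _ (s≤s z≤n) (e x d)
  where
  e : ∀ x d → (2 + x + d) * (1 + (1 + x) * (1 + x)) + (1 + d) * (1 + 3 * x + d + x * x + x * d)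
            ≡ (1 + x) * (1 + (2 + x + d) * (2 + x + d))
  e = solve-∀

-- (a + a²)/φ a = a/(1 + a²) is decreasing: φ x = (1 + x)(1 + x²) and the factors (1 + a)(1 + A) cancel.
φ-middle-anti : ∀ {a A} → 0 < a → a < A → φ a * (A + A * A) < φ A * (a + a * a)
φ-middle-anti {a} {A} 0<a a<A = begin-strict
  φ a * (A + A * A)               ≡⟨ e a A ⟩
  (1 + a) * (1 + A) * (A * (1 + a * a)) <⟨ *-monoʳ-< ((1 + a) * (1 + A)) (y[1+x²]<x[1+y²] 0<a a<A) ⟩
  (1 + a) * (1 + A) * (a * (1 + A * A)) ≡⟨ cong (_* (a * (1 + A * A))) (*-comm (1 + a) (1 + A)) ⟩
  (1 + A) * (1 + a) * (a * (1 + A * A)) ≡⟨ e A a ⟨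
  φ A * (a + a * a)               ∎
  where
  open ≤-Reasoning
  e : ∀ a A → (a * a * a + (a * a + (a + 1))) * (A + A * A) ≡ (1 + a) * (1 + A) * (A * (1 + a * a))
  e = solve-∀

-- φ a φ A = φ a (1 + A³) + φ a (A + A²) = φ A (1 + a³) + φ A (a + a²): the outer terms cancel.
φ-outer-cancel : ∀ {a A s S} →
  φ a * S + φ A * (a + a * a) < φ A * s + φ a * (A + A * A) →
  φ a * (1 + (S + A * A * A)) < φ A * (1 + (s + a * a * a))
φ-outer-cancel {a} {A} {s} {S} h = +-cancelʳ-< K _ _ (begin-strict
  φ a * (1 + (S + A * A * A)) + K         ≡⟨ e a A S ⟩
  φ a * S + φ A * (a + a * a) + φ a * φ A <⟨ +-monoˡ-< (φ a * φ A) h ⟩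
  φ A * s + φ a * (A + A * A) + φ a * φ A ≡⟨ e′ a A s ⟩
  φ A * (1 + (s + a * a * a)) + K         ∎)
  where
  open ≤-Reasoning
  K = φ a * (A + A * A) + φ A * (a + a * a)
  e : ∀ a A S → let φa = a * a * a + (a * a + (a + 1)); φA = A * A * A + (A * A + (A + 1)) in
      φa * (1 + (S + A * A * A)) + (φa * (A + A * A) + φA * (a + a * a)) ≡ φa * S + φA * (a + a * a) + φa * φA
  e = solve-∀
  e′ : ∀ a A s → let φa = a * a * a + (a * a + (a + 1)); φA = A * A * A + (A * A + (A + 1)) in
      φA * s + φa * (A + A * A) + φa * φA ≡ φA * (1 + (s + a * a * a)) + (φa * (A + A * A) + φA * (a + a * a))
  e′ = solve-∀

-- After multiplying by b B both sides are a common part plus b c D′ resp. B c′ D = b w c′ D.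
cross-< : ∀ {b w B s t m m′ c c′ D D′} → 0 < b → B ≡ b * w →
  b * s ≡ b * m + D → B * t ≡ B * m′ + D′ → c * D′ < w * (c′ * D) →
  c * t + c′ * m < c′ * s + c * m′
cross-< {b} {w} {_} {s} {t} {m} {m′} {c} {c′} {D} {D′} 0<b refl hs ht h = *-cancelˡ-< (b * B) _ _ (begin-strict
  b * B * (c * t + c′ * m)                    ≡⟨ e₁ b w c c′ t m ⟩
  c * b * (B * t) + c′ * B * (b * m)          ≡⟨ cong (λ x → c * b * x + c′ * B * (b * m)) ht ⟩
  c * b * (B * m′ + D′) + c′ * B * (b * m)    ≡⟨ e₂ b w c c′ m m′ D′ ⟩
  c * b * B * m′ + c′ * B * (b * m) + b * (c * D′)
    <⟨ +-monoʳ-< _ (*-monoʳ-< b {{>-nonZero 0<b}} h) ⟩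
  c * b * B * m′ + c′ * B * (b * m) + b * (w * (c′ * D)) ≡⟨ e₃ b w c c′ m m′ D ⟩
  c * b * B * m′ + c′ * B * (b * m + D)       ≡⟨ cong (λ x → c * b * B * m′ + c′ * B * x) hs ⟨
  c * b * B * m′ + c′ * B * (b * s)           ≡⟨ e₄ b w c c′ s m′ ⟩
  b * B * (c′ * s + c * m′)                   ∎)
  where
  open ≤-Reasoning
  B = b * w
  e₁ : ∀ b w c c′ t m → b * (b * w) * (c * t + c′ * m) ≡ c * b * (b * w * t) + c′ * (b * w) * (b * m)
  e₁ = solve-∀
  e₂ : ∀ b w c c′ m m′ D′ → c * b * (b * w * m′ + D′) + c′ * (b * w) * (b * m)
                           ≡ c * b * (b * w) * m′ + c′ * (b * w) * (b * m) + b * (c * D′)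
  e₂ = solve-∀
  e₃ : ∀ b w c c′ m m′ D → c * b * (b * w) * m′ + c′ * (b * w) * (b * m) + b * (w * (c′ * D))
                         ≡ c * b * (b * w) * m′ + c′ * (b * w) * (b * m + D)
  e₃ = solve-∀
  e₄ : ∀ b w c c′ s m′ → c * b * (b * w) * m′ + c′ * (b * w) * (b * s) ≡ b * (b * w) * (c′ * s + c * m′)
  e₄ = solve-∀

-- b + a³/b − a − a² = (a − b)(a² − b)/b.
pair-excess : ∀ {a b c Δ Θ} → a ≡ b + Δ → a * a ≡ b + Θ → b * c ≡ a * a * a →
  b * (b + c) ≡ b * (a + a * a) + Δ * Θ
pair-excess {a} {b} {c} {Δ} {Θ} ha haa hc = begin
  b * (b + c)                      ≡⟨ *-distribˡ-+ b b c ⟩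
  b * b + b * c                    ≡⟨ cong (b * b +_) hc ⟩
  b * b + a * a * a                ≡⟨ cong₂ (λ x y → b * b + x * y) haa ha ⟩
  b * b + (b + Θ) * (b + Δ)        ≡⟨ e b Δ Θ ⟩
  b * ((b + Δ) + (b + Θ)) + Δ * Θ  ≡⟨ cong₂ (λ x y → b * (x + y) + Δ * Θ) ha haa ⟨
  b * (a + a * a) + Δ * Θ          ∎
  where
  open ≡-Reasoning
  e : ∀ b Δ Θ → b * b + (b + Θ) * (b + Δ) ≡ b * ((b + Δ) + (b + Θ)) + Δ * Θ
  e = solve-∀

pair-deficit : ∀ {a b c Δ Θ} → b ≡ a + Δ → a * a ≡ b + Θ → b * c ≡ a * a * a →
  b * (a + a * a) ≡ b * (b + c) + Δ * Θ
pair-deficit {a} {b} {c} {Δ} {Θ} hb haa hc = begin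
  b * (a + a * a)                             ≡⟨ cong (λ x → b * (a + x)) haa ⟩
  b * (a + (b + Θ))                           ≡⟨ cong (λ x → x * (a + (x + Θ))) hb ⟩
  (a + Δ) * (a + ((a + Δ) + Θ))               ≡⟨ e a Δ Θ ⟩
  (a + Δ) * (a + Δ) + a * (a + Δ + Θ) + Δ * Θ ≡⟨ cong (λ x → x * x + a * (x + Θ) + Δ * Θ) hb ⟨
  b * b + a * (b + Θ) + Δ * Θ                 ≡⟨ cong (λ x → b * b + a * x + Δ * Θ) haa ⟨
  b * b + a * (a * a) + Δ * Θ                 ≡⟨ cong (λ x → b * b + x + Δ * Θ) (trans hc (*-assoc a a a)) ⟨
  b * b + b * c + Δ * Θ                       ≡⟨ cong (_+ Δ * Θ) (*-distribˡ-+ b b c) ⟨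
  b * (b + c) + Δ * Θ                         ∎
  where
  open ≡-Reasoning
  e : ∀ a Δ Θ → (a + Δ) * (a + ((a + Δ) + Θ)) ≡ (a + Δ) * (a + Δ) + a * (a + Δ + Θ) + Δ * Θ
  e = solve-∀

-- 8 φ a ≤ 15 a³ and φ A ≥ a³ y³, so both sides are compared through Δ a⁵ y².
pair-key : ∀ {a y A v w J Δ Θ E F} → 2 ≤ a → 0 < y → 0 < Δ → A ≡ a * y →
  E ≤ suc J * v * Δ → F ≤ A * A → a * a ≤ 2 * Θ → 30 * suc J * v < 8 * w * y →
  φ a * (E * F) < w * (φ A * (Δ * Θ))
pair-key {a} {y} {_} {v} {w} {J} {Δ} {Θ} {E} {F} 2≤a 0<y 0<Δ refl hE hF hΘ hc =
  *-cancelˡ-< 16 _ _ (begin-strict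
    16 * (φ a * (E * F))                                  ≡⟨ e₁ (φ a) E F ⟩
    2 * (8 * φ a) * E * F                                 ≤⟨ *-mono-≤ (*-mono-≤ (*-monoʳ-≤ 2 (φ-upper 2≤a)) hE) hF ⟩
    2 * (15 * (a * a * a)) * (suc J * v * Δ) * (a * y * (a * y)) ≡⟨ e₂ a J v Δ y ⟩
    30 * suc J * v * Z                                    <⟨ *-monoˡ-< Z {{>-nonZero 0<Z}} hc ⟩
    8 * w * y * Z                                         ≡⟨ e₃ w y Δ a ⟩
    8 * w * Δ * (a * a) * (a * y * (a * y) * (a * y))     ≤⟨ *-monoʳ-≤ (8 * w * Δ * (a * a)) (φ-lower (a * y)) ⟩
    8 * w * Δ * (a * a) * φ (a * y)                       ≤⟨ *-monoˡ-≤ (φ (a * y)) (*-monoʳ-≤ (8 * w * Δ) hΘ) ⟩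
    8 * w * Δ * (2 * Θ) * φ (a * y)                       ≡⟨ e₄ w Δ Θ (φ (a * y)) ⟩
    16 * (w * (φ (a * y) * (Δ * Θ)))                      ∎)
  where
  open ≤-Reasoning
  Z = Δ * (a * a * a * a * a) * (y * y)
  0<a : 0 < a
  0<a = ≤-trans (s≤s z≤n) 2≤a
  0<Z : 0 < Z
  0<Z = *-mono-< (*-mono-< 0<Δ (*-mono-< (*-mono-< (*-mono-< (*-mono-< 0<a 0<a) 0<a) 0<a) 0<a)) (*-mono-< 0<y 0<y)
  e₁ : ∀ x E F → 16 * (x * (E * F)) ≡ 2 * (8 * x) * E * F
  e₁ = solve-∀
  e₂ : ∀ a J v Δ y → 2 * (15 * (a * a * a)) * ((1 + J) * v * Δ) * (a * y * (a * y))
                   ≡ 30 * (1 + J) * v * (Δ * (a * a * a * a * a) * (y * y))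
  e₂ = solve-∀
  e₃ : ∀ w y Δ a → 8 * w * y * (Δ * (a * a * a * a * a) * (y * y)) ≡ 8 * w * Δ * (a * a) * (a * y * (a * y) * (a * y))
  e₃ = solve-∀
  e₄ : ∀ w Δ Θ x → 8 * w * Δ * (2 * Θ) * x ≡ 16 * (w * (x * (Δ * Θ)))
  e₄ = solve-∀

-- Applied to u = d³ for the divisors d of n with 2d ≤ n.
proper-term-≤ : ∀ {n u k j} → 1 ≤ k → 1 ≤ j → 2 ≤ n → 8 * u ≤ n * n * n →
  φ (n ^ k) * u ^ (k + j) ≤ φ (n ^ (k + j)) * u ^ k
proper-term-≤ {n} {u} {suc k} {suc j} _ _ 2≤n 8u≤n³ = begin
  φ a * u ^ (suc k + suc j)  ≡⟨ cong (φ a *_) (^-distribˡ-+-* u (suc k) (suc j)) ⟩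
  φ a * (U * W)              ≡⟨ e (φ a) U W ⟩
  U * (φ a * W)              ≤⟨ *-monoʳ-≤ U (*-cancelˡ-≤ 64 φaW≤) ⟩
  U * φ (a * y)              ≡⟨ cong (λ x → U * φ x) (^-distribˡ-+-* n (suc k) (suc j)) ⟨
  U * φ (n ^ (suc k + suc j)) ≡⟨ *-comm U _ ⟩
  φ (n ^ (suc k + suc j)) * U ∎
  where
  open ≤-Reasoning
  a = n ^ suc k
  y = n ^ suc j
  U = u ^ suc k
  W = u ^ suc j
  2≤a : 2 ≤ a
  2≤a = ≤-trans 2≤n (m≤m^n {n} {suc k} (≤-trans (s≤s z≤n) 2≤n) (s≤s z≤n))
  e : ∀ x U W → x * (U * W) ≡ U * (x * W)
  e = solve-∀
  8W≤y³ : 8 * W ≤ y * y * y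
  8W≤y³ = begin
    8 * W              ≤⟨ *-monoˡ-≤ W (m≤m^n {8} {suc j} (s≤s z≤n) (s≤s z≤n)) ⟩
    8 ^ suc j * W      ≡⟨ ^-distribʳ-* 8 u (suc j) ⟨
    (8 * u) ^ suc j    ≤⟨ ^-monoˡ-≤ (suc j) 8u≤n³ ⟩
    (n * n * n) ^ suc j ≡⟨ ^-distribʳ-* (n * n) n (suc j) ⟩
    (n * n) ^ suc j * y ≡⟨ cube-product-^ {n * n} {n} {n} (suc j) refl ⟩
    y * y * y          ∎
  φaW≤ : 64 * (φ a * W) ≤ 64 * φ (a * y)
  φaW≤ = begin
    64 * (φ a * W)                 ≡⟨ e₁ (φ a) W ⟩
    8 * φ a * (8 * W)              ≤⟨ *-mono-≤ (φ-upper 2≤a) 8W≤y³ ⟩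
    15 * (a * a * a) * (y * y * y) ≤⟨ ≤-by (49 * (a * a * a) * (y * y * y)) (e₂ a y) ⟩
    64 * (a * y * (a * y) * (a * y)) ≤⟨ *-monoʳ-≤ 64 (φ-lower (a * y)) ⟩
    64 * φ (a * y)                 ∎
    where
    e₁ : ∀ x W → 64 * (x * W) ≡ 8 * x * (8 * W)
    e₁ = solve-∀
    e₂ : ∀ a y → 15 * (a * a * a) * (y * y * y) + 49 * (a * a * a) * (y * y * y) ≡ 64 * (a * y * (a * y) * (a * y))
    e₂ = solve-∀

-- For complementary divisors d, n/d with u = d³ < n and v = (n/d)³, the excess u^e + v^e − n^e − n^{2e} > 0
-- of their terms over the middle terms of φ(n^e) decreases relative to φ(n^e) from e = k to e = k + j.
excess-decreasing : ∀ {n u v k j} → 1 ≤ k → 2 ≤ j → 8 ≤ u → u < n → u * v ≡ n * n * n →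
  let a = n ^ k; A = n ^ (k + j) in
  φ a * (u ^ (k + j) + v ^ (k + j)) + φ A * (a + a * a) < φ A * (u ^ k + v ^ k) + φ a * (A + A * A)
excess-decreasing {n} {u} {v} {k} {j} 1≤k 2≤j 8≤u u<n uv =
  cross-< {s = u ^ k + v ^ k} {t = B + v ^ (k + j)} {m = a + a * a} {m′ = A + A * A} {c = φ a} {c′ = φ A}
    0<b (^-distribˡ-+-* u k j)
    (pair-excess {a} {b} {v ^ k} (sym (m+[n∸m]≡n b≤a)) (sym (m+[n∸m]≡n b≤aa)) (cube-product-^ k uv))
    (pair-excess {A} {B} {v ^ (k + j)} (sym (m+[n∸m]≡n (<⇒≤ B<A))) (sym (m+[n∸m]≡n B≤AA)) (cube-product-^ (k + j) uv))
    (pair-key {v = n ^ j} {w = u ^ j} {J = j} {Θ = a * a ∸ b} 2≤a (m^n>0 n {{n≢0}} j) (m<n⇒0<n∸m b<a) (^-distribˡ-+-* n k j)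
       (pow-gap j 1≤k (<⇒≤ u<n)) (m∸n≤m (A * A) B) (half-≤ {b} 2b≤aa)
       (*-monoˡ-< (n ^ j) {{m^n≢0 n j {{n≢0}}}} (linear<exponential (≤-trans (≤-by 4 refl) 8≤u) 2≤j)))
  where
  a = n ^ k
  A = n ^ (k + j)
  b = u ^ k
  B = u ^ (k + j)
  u≢0 : NonZero u
  u≢0 = >-nonZero (≤-trans (s≤s z≤n) 8≤u)
  n≢0 : NonZero n
  n≢0 = >-nonZero (≤-trans (s≤s z≤n) u<n)
  0<b : 0 < b
  0<b = m^n>0 u {{u≢0}} k
  b<a : b < a
  b<a = ^-monoˡ-< k {{>-nonZero 1≤k}} u<n
  B<A : B < A
  B<A = ^-monoˡ-< (k + j) {{>-nonZero (≤-trans 1≤k (m≤m+n k j))}} u<n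
  b≤a : b ≤ a
  b≤a = <⇒≤ b<a
  2≤a : 2 ≤ a
  2≤a = ≤-trans (≤-trans (≤-by 6 refl) (<⇒≤ (≤-<-trans 8≤u u<n))) (m≤m^n (≤-<-trans z≤n u<n) 1≤k)
  2b≤aa : 2 * b ≤ a * a
  2b≤aa = ≤-trans (*-monoʳ-≤ 2 b≤a) (*-monoˡ-≤ a 2≤a)
  b≤aa : b ≤ a * a
  b≤aa = 2*m≤n⇒m≤n 2b≤aa
  B≤AA : B ≤ A * A
  B≤AA = ≤-trans (<⇒≤ B<A) (m≤m*n A A {{m^n≢0 n (k + j) {{n≢0}}}})

-- For n < u ≤ v the pair falls short of the middle terms instead, by a deficit that likewise decreases.
deficit-decreasing : ∀ {n u v k j} → 1 ≤ k → 2 ≤ j → 4 ≤ n → n < u → u ≤ v → u * v ≡ n * n * n →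
  let a = n ^ k; A = n ^ (k + j) in
  φ A * (u ^ k + v ^ k) + φ a * (A + A * A) < φ a * (u ^ (k + j) + v ^ (k + j)) + φ A * (a + a * a)
deficit-decreasing {n} {u} {v} {k} {j} 1≤k 2≤j 4≤n n<u u≤v uv =
  subst₂ _<_ (+-comm (φ a * (A + A * A)) (φ A * (u ^ k + v ^ k))) (+-comm (φ A * (a + a * a)) (φ a * (B + v ^ (k + j))))
  (cross-< {s = a + a * a} {t = A + A * A} {m = u ^ k + v ^ k} {m′ = B + v ^ (k + j)} {c = φ a} {c′ = φ A}
    0<b (^-distribˡ-+-* u k j)
    (pair-deficit {a} {b} {v ^ k} (sym (m+[n∸m]≡n (<⇒≤ a<b))) (sym (m+[n∸m]≡n (2*m≤n⇒m≤n {b} 2b≤aa))) (cube-product-^ k uv))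
    (pair-deficit {A} {B} {v ^ (k + j)} (sym (m+[n∸m]≡n (<⇒≤ A<B))) (sym (m+[n∸m]≡n (2*m≤n⇒m≤n {B} 2B≤AA)))
      (cube-product-^ (k + j) uv))
    (pair-key {v = u ^ j} {w = u ^ j} {J = j} {Θ = a * a ∸ b} 2≤a (m^n>0 n {{n≢0}} j) (m<n⇒0<n∸m a<b)
       (^-distribˡ-+-* n k j) (pow-gap j 1≤k (<⇒≤ n<u)) (m∸n≤m (A * A) B) (half-≤ {b} 2b≤aa)
       (subst (30 * suc j * u ^ j <_) (e (n ^ j) (u ^ j))
         (*-monoˡ-< (u ^ j) {{m^n≢0 u j {{u≢0}}}} (linear<exponential 4≤n 2≤j)))))
  where
  a = n ^ k
  A = n ^ (k + j)
  b = u ^ k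
  B = u ^ (k + j)
  e : ∀ y w → 8 * y * w ≡ 8 * w * y
  e = solve-∀
  n≢0 : NonZero n
  n≢0 = >-nonZero (≤-trans (s≤s z≤n) 4≤n)
  u≢0 : NonZero u
  u≢0 = >-nonZero (≤-<-trans z≤n n<u)
  0<b : 0 < b
  0<b = m^n>0 u {{u≢0}} k
  a<b : a < b
  a<b = ^-monoˡ-< k {{>-nonZero 1≤k}} n<u
  A<B : A < B
  A<B = ^-monoˡ-< (k + j) {{>-nonZero (≤-trans 1≤k (m≤m+n k j))}} n<u
  4≤a : 4 ≤ a
  4≤a = ≤-trans 4≤n (m≤m^n {n} {k} (≤-trans (s≤s z≤n) 4≤n) 1≤k)
  2≤a : 2 ≤ a
  2≤a = ≤-trans (≤-by 2 refl) 4≤a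
  4≤A : 4 ≤ A
  4≤A = ≤-trans 4≤n (m≤m^n {n} {k + j} (≤-trans (s≤s z≤n) 4≤n) (≤-trans 1≤k (m≤m+n k j)))
  2b≤aa : 2 * b ≤ a * a
  2b≤aa = square-double-≤ {a} {b} 4≤a (≤-trans (*-monoʳ-≤ b (^-monoˡ-≤ k u≤v)) (≤-reflexive (cube-product-^ k uv)))
  2B≤AA : 2 * B ≤ A * A
  2B≤AA = square-double-≤ {A} {B} 4≤A (≤-trans (*-monoʳ-≤ B (^-monoˡ-≤ (k + j) u≤v)) (≤-reflexive (cube-product-^ (k + j) uv)))

-- Divisors

least-factor : ∀ {n} → 2 ≤ n → ∃ λ p → 2 ≤ p × p ∣ n × p Rough n
least-factor {n} 2≤n = search (n ∸ 2) 2 (m+[n∸m]≡n 2≤n) ≤-refl (2-rough {n})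
  where
  search : ∀ k m → m + k ≡ n → 2 ≤ m → m Rough n → ∃ λ p → 2 ≤ p × p ∣ n × p Rough n
  search k m m+k≡n 2≤m r with m ∣? n
  ... | yes m∣n = m , 2≤m , m∣n , r
  search zero m m+0≡n 2≤m r | no m∤n = contradiction (∣-reflexive (trans (sym (+-identityʳ m)) m+0≡n)) m∤n
  search (suc k) m m+k≡n 2≤m r | no m∤n =
    search k (suc m) (trans (sym (+-suc m k)) m+k≡n) (m≤n⇒m≤1+n 2≤m) (∤⇒rough-suc m∤n r)

coprime-to-prime : ∀ {p x} → Prime p → ¬ (p ∣ x) → Coprime x p
coprime-to-prime pp p∤x (d∣x , d∣p) with prime⇒irreducible pp d∣p
... | inj₁ d≡1 = d≡1
... | inj₂ refl = contradiction d∣x p∤x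

prime-power-divisor : ∀ {p d} e → Prime p → d ∣ p ^ e → ∃ λ i → i ≤ e × d ≡ p ^ i
prime-power-divisor zero pp d∣1 = 0 , z≤n , ∣1⇒≡1 d∣1
prime-power-divisor {p} {d} (suc e) pp d∣pp^e with p ∣? d
... | yes (divides d′ refl) with prime-power-divisor e pp
        (*-cancelˡ-∣ p {{prime⇒nonZero pp}} (subst (_∣ p * p ^ e) (*-comm d′ p) d∣pp^e))
...   | i , i≤e , refl = suc i , s≤s i≤e , *-comm (p ^ i) p
prime-power-divisor {p} {d} (suc e) pp d∣pp^e | no p∤d
  with prime-power-divisor e pp (coprime-divisor (coprime-to-prime pp p∤d) d∣pp^e)
... | i , i≤e , d≡p^i = i , m≤n⇒m≤1+n i≤e , d≡p^i

prime-product-divisor : ∀ {p q d} → Prime p → Prime q → d ∣ p * q → d ≡ 1 ⊎ d ≡ p ⊎ d ≡ q ⊎ d ≡ p * q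
prime-product-divisor {p} {q} {d} pp pq d∣pq with p ∣? d
... | yes (divides d′ refl)
  with prime⇒irreducible pq (*-cancelˡ-∣ p {{prime⇒nonZero pp}} (subst (_∣ p * q) (*-comm d′ p) d∣pq))
...   | inj₁ refl = inj₂ (inj₁ (*-identityˡ p))
...   | inj₂ refl = inj₂ (inj₂ (inj₂ (*-comm q p)))
prime-product-divisor {p} {q} {d} pp pq d∣pq | no p∤d
  with prime⇒irreducible pq (coprime-divisor (coprime-to-prime pp p∤d) d∣pq)
... | inj₁ d≡1 = inj₁ d≡1
... | inj₂ d≡q = inj₂ (inj₂ (inj₁ d≡q))

proper-divisor-double : ∀ {d n} → d ∣ n → 0 < n → d ≢ n → 2 * d ≤ n
proper-divisor-double (divides zero refl) () _
proper-divisor-double {d} (divides (suc zero) refl) _ d≢n = contradiction (sym (+-identityʳ d)) d≢n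
proper-divisor-double {d} (divides (suc (suc q)) refl) _ _ = *-monoˡ-≤ d (s≤s (s≤s (z≤n {q})))

prime>1 : ∀ {p} → Prime p → 1 < p
prime>1 {p} pp = nonTrivial⇒n>1 p {{prime⇒nonTrivial pp}}

^-∣ : ∀ p {i e} → i ≤ e → p ^ i ∣ p ^ e
^-∣ p {i} {e} i≤e = divides (p ^ (e ∸ i)) (trans (cong (p ^_) (sym (m∸n+n≡m i≤e))) (^-distribˡ-+-* p (e ∸ i) i))

cofactor-prime : ∀ {p n m} → p Rough n → n ≡ p * m → 2 ≤ m → m < p * p → Prime m
cofactor-prime {p} {n} {m} r n≡pm 2≤m m<pp =
  rough∧square>⇒prime {{n>1⇒nonTrivial 2≤m}} (rough∧∣⇒rough r (divides p n≡pm)) m<pp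

∑ : ℕ → (ℕ → ℕ) → ℕ
∑ zero f = 0
∑ (suc N) f = f 0 + ∑ N (f ∘ suc)

∑-zero : ∀ N {f} → (∀ x → f x ≡ 0) → ∑ N f ≡ 0
∑-zero zero h = refl
∑-zero (suc N) h = cong₂ _+_ (h 0) (∑-zero N (h ∘ suc))

∑-mono-≤ : ∀ N {f g} → (∀ x → f x ≤ g x) → ∑ N f ≤ ∑ N g
∑-mono-≤ zero h = z≤n
∑-mono-≤ (suc N) h = +-mono-≤ (h 0) (∑-mono-≤ N (h ∘ suc))

*-distribˡ-∑ : ∀ N c f → c * ∑ N f ≡ ∑ N (λ x → c * f x)
*-distribˡ-∑ zero c f = *-zeroʳ c
*-distribˡ-∑ (suc N) c f = trans (*-distribˡ-+ c (f 0) _) (cong (c * f 0 +_) (*-distribˡ-∑ N c (f ∘ suc)))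

erase : ℕ → (ℕ → ℕ) → ℕ → ℕ
erase a f x = if x ≡ᵇ a then 0 else f x

erase-≢ : ∀ {a x} f → x ≢ a → erase a f x ≡ f x
erase-≢ {a} {x} f x≢a with x ≡ᵇ a in eq
... | true = contradiction (≡ᵇ⇒≡ x a (subst T (sym eq) _)) x≢a
... | false = refl

∑-erase : ∀ N f {a} → a < N → ∑ N f ≡ f a + ∑ N (erase a f)
∑-erase (suc N) f {zero} _ = refl
∑-erase (suc N) f {suc a} (s≤s a<N) = begin
  f 0 + ∑ N (f ∘ suc)                               ≡⟨ cong (f 0 +_) (∑-erase N (f ∘ suc) a<N) ⟩
  f 0 + (f (suc a) + ∑ N (erase a (f ∘ suc)))       ≡⟨ +-comm (f 0) _ ⟩
  f (suc a) + ∑ N (erase a (f ∘ suc)) + f 0         ≡⟨ +-assoc (f (suc a)) _ (f 0) ⟩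
  f (suc a) + (∑ N (erase a (f ∘ suc)) + f 0)       ≡⟨ cong (f (suc a) +_) (+-comm _ (f 0)) ⟩
  f (suc a) + (f 0 + ∑ N (erase a (f ∘ suc)))       ∎
  where open ≡-Reasoning

eraseAll : List ℕ → (ℕ → ℕ) → ℕ → ℕ
eraseAll [] f = f
eraseAll (a ∷ as) f = eraseAll as (erase a f)

map-erase : ∀ {a} f {as} → All (a ≢_) as → map (erase a f) as ≡ map f as
map-erase f [] = refl
map-erase f (a≢x ∷ a≢xs) = cong₂ _∷_ (erase-≢ f (a≢x ∘ sym)) (map-erase f a≢xs)

∑-eraseAll : ∀ N f {as} → AllPairs _≢_ as → All (_< N) as → ∑ N f ≡ sum (map f as) + ∑ N (eraseAll as f)
∑-eraseAll N f [] [] = refl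
∑-eraseAll N f {a ∷ as} (a≢as ∷ distinct) (a<N ∷ as<N) = begin
  ∑ N f                                                     ≡⟨ ∑-erase N f a<N ⟩
  f a + ∑ N (erase a f)                                     ≡⟨ cong (f a +_) (∑-eraseAll N (erase a f) distinct as<N) ⟩
  f a + (sum (map (erase a f) as) + ∑ N (eraseAll as (erase a f)))
    ≡⟨ cong (λ xs → f a + (sum xs + ∑ N (eraseAll as (erase a f)))) (map-erase f a≢as) ⟩
  f a + (sum (map f as) + ∑ N (eraseAll as (erase a f)))   ≡⟨ +-assoc (f a) _ _ ⟨
  f a + sum (map f as) + ∑ N (eraseAll as (erase a f))     ∎
  where open ≡-Reasoning

eraseAll-pointwise : ∀ (R : ℕ → ℕ → Set) → R 0 0 → ∀ as {f g} →
  (∀ x → x ∉ as → R (f x) (g x)) → ∀ x → R (eraseAll as f x) (eraseAll as g x)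
eraseAll-pointwise R r₀ [] h x = h x λ ()
eraseAll-pointwise R r₀ (a ∷ as) {f} {g} h = eraseAll-pointwise R r₀ as h′
  where
  h′ : ∀ x → x ∉ as → R (erase a f x) (erase a g x)
  h′ x x∉as with x ≡ᵇ a in eq
  ... | true = r₀
  ... | false = h x λ { (here x≡a) → subst T eq (≡⇒≡ᵇ x a x≡a) ; (there x∈as) → x∉as x∈as }

divisorPower : ℕ → ℕ → ℕ → ℕ
divisorPower n s d = if does (d ∣? n) then d ^ s else 0

divisorPower-∣ : ∀ {n d} s → d ∣ n → divisorPower n s d ≡ d ^ s
divisorPower-∣ {n} {d} s d∣n rewrite dec-true (d ∣? n) d∣n = refl

divisorPower-∤ : ∀ {n d} s → ¬ d ∣ n → divisorPower n s d ≡ 0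
divisorPower-∤ {n} {d} s d∤n rewrite dec-false (d ∣? n) d∤n = refl

σ≡∑ : ∀ s n → σ s n ≡ ∑ (suc n) (divisorPower n s)
σ≡∑ s n = trans (filter-sum (upTo (suc n))) (sum-applyUpTo (suc n) (divisorPower n s) (λ x → x))
  where
  filter-sum : ∀ xs → sum (map (_^ s) (filter (_∣? n) xs)) ≡ sum (map (divisorPower n s) xs)
  filter-sum [] = refl
  filter-sum (x ∷ xs) with does (x ∣? n)
  ... | true = cong (x ^ s +_) (filter-sum xs)
  ... | false = filter-sum xs
  sum-applyUpTo : ∀ N (f g : ℕ → ℕ) → sum (map f (applyUpTo g N)) ≡ ∑ N (f ∘ g)
  sum-applyUpTo zero f g = refl
  sum-applyUpTo (suc N) f g = cong (f (g 0) +_) (sum-applyUpTo N f (g ∘ suc))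

σ-split : ∀ {n} s {ds} → .{{NonZero n}} → Linked _<_ ds → All (_∣ n) ds →
  σ s n ≡ sum (map (_^ s) ds) + ∑ (suc n) (eraseAll ds (divisorPower n s))
σ-split {n} s {ds} increasing ds∣n = begin
  σ s n                                                              ≡⟨ σ≡∑ s n ⟩
  ∑ (suc n) (divisorPower n s)                                      ≡⟨ ∑-eraseAll (suc n) (divisorPower n s) distinct bounded ⟩
  sum (map (divisorPower n s) ds) + ∑ (suc n) (eraseAll ds (divisorPower n s))
    ≡⟨ cong (λ xs → sum xs + ∑ (suc n) (eraseAll ds (divisorPower n s))) (map-divisorPower ds∣n) ⟩
  sum (map (_^ s) ds) + ∑ (suc n) (eraseAll ds (divisorPower n s)) ∎
  where
  open ≡-Reasoning
  distinct : AllPairs _≢_ ds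
  distinct = AllPairs.map <⇒≢ (Linked⇒AllPairs <-trans increasing)
  bounded : All (_< suc n) ds
  bounded = All.map (s≤s ∘ ∣⇒≤) ds∣n
  map-divisorPower : ∀ {xs} → All (_∣ n) xs → map (divisorPower n s) xs ≡ map (_^ s) xs
  map-divisorPower [] = refl
  map-divisorPower (x∣n ∷ xs∣n) = cong₂ _∷_ (divisorPower-∣ s x∣n) (map-divisorPower xs∣n)

σ-divisors : ∀ {n} s {ds} → .{{NonZero n}} → Linked _<_ ds → All (_∣ n) ds → (∀ {d} → d ∣ n → d ∈ ds) →
  σ s n ≡ sum (map (_^ s) ds)
σ-divisors {n} s {ds} increasing ds∣n complete = begin
  σ s n                                                              ≡⟨ σ-split s increasing ds∣n ⟩
  sum (map (_^ s) ds) + ∑ (suc n) (eraseAll ds (divisorPower n s))  ≡⟨ cong (sum (map (_^ s) ds) +_) rest≡0 ⟩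
  sum (map (_^ s) ds) + 0                                            ≡⟨ +-identityʳ _ ⟩
  sum (map (_^ s) ds)                                                ∎
  where
  open ≡-Reasoning
  rest≡0 : ∑ (suc n) (eraseAll ds (divisorPower n s)) ≡ 0
  rest≡0 = ∑-zero (suc n) {eraseAll ds (divisorPower n s)} (eraseAll-pointwise (λ x _ → x ≡ 0) refl ds {g = divisorPower n s}
    (λ x x∉ds → divisorPower-∤ s (λ x∣n → x∉ds (complete x∣n))))

σ-cross-< : ∀ {n c c′ s t ds} → .{{NonZero n}} → Linked _<_ ds → All (_∣ n) ds →
  c * sum (map (_^ s) ds) < c′ * sum (map (_^ t) ds) →
  (∀ {d} → d ∣ n → d ∉ ds → c * d ^ s ≤ c′ * d ^ t) →
  c * σ s n < c′ * σ t n
σ-cross-< {n} {c} {c′} {s} {t} {ds} increasing ds∣n listed others = begin-strict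
  c * σ s n                           ≡⟨ cong (c *_) (σ-split s increasing ds∣n) ⟩
  c * (sum (map (_^ s) ds) + R s)     ≡⟨ *-distribˡ-+ c _ _ ⟩
  c * sum (map (_^ s) ds) + c * R s   <⟨ +-mono-<-≤ listed rest ⟩
  c′ * sum (map (_^ t) ds) + c′ * R t ≡⟨ *-distribˡ-+ c′ _ _ ⟨
  c′ * (sum (map (_^ t) ds) + R t)    ≡⟨ cong (c′ *_) (σ-split t increasing ds∣n) ⟨
  c′ * σ t n                          ∎
  where
  open ≤-Reasoning
  R : ℕ → ℕ
  R e = ∑ (suc n) (eraseAll ds (divisorPower n e))
  term : ∀ x → x ∉ ds → c * divisorPower n s x ≤ c′ * divisorPower n t x
  term x x∉ds with x ∣? n
  ... | yes x∣n = others x∣n x∉ds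
  ... | no _ = ≤-reflexive (trans (*-zeroʳ c) (sym (*-zeroʳ c′)))
  rest : c * R s ≤ c′ * R t
  rest = begin
    c * R s ≡⟨ *-distribˡ-∑ (suc n) c (eraseAll ds (divisorPower n s)) ⟩
    ∑ (suc n) (λ x → c * eraseAll ds (divisorPower n s) x)
      ≤⟨ ∑-mono-≤ (suc n) {λ x → c * eraseAll ds (divisorPower n s) x} {λ x → c′ * eraseAll ds (divisorPower n t) x}
           (eraseAll-pointwise (λ u v → c * u ≤ c′ * v)
                             (≤-reflexive (trans (*-zeroʳ c) (sym (*-zeroʳ c′)))) ds term) ⟩
    ∑ (suc n) (λ x → c′ * eraseAll ds (divisorPower n t) x) ≡⟨ *-distribˡ-∑ (suc n) c′ (eraseAll ds (divisorPower n t)) ⟨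
    c′ * R t ∎

-- The coefficients of g

-- ℕ→ℚ n is by definition fromℚᵘ (mkℚᵘ (ℤ.+ n) 0).
toℚᵘ-ℕ→ℚ : ∀ n → toℚᵘ (ℕ→ℚ n) ℚᵘ.≃ ℚᵘ.mkℚᵘ (ℤ.+ n) 0
toℚᵘ-ℕ→ℚ n = ℚ.toℚᵘ-fromℚᵘ (ℚᵘ.mkℚᵘ (ℤ.+ n) 0)

ℕ→ℚ-+ : ∀ m n → ℕ→ℚ m ℚ.+ ℕ→ℚ n ≡ ℕ→ℚ (m + n)
ℕ→ℚ-+ m n = ℚ.toℚᵘ-injective (begin
  toℚᵘ (ℕ→ℚ m ℚ.+ ℕ→ℚ n)                ≈⟨ ℚ.toℚᵘ-homo-+ (ℕ→ℚ m) (ℕ→ℚ n) ⟩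
  toℚᵘ (ℕ→ℚ m) ℚᵘ.+ toℚᵘ (ℕ→ℚ n)       ≈⟨ ℚᵘ.+-cong (toℚᵘ-ℕ→ℚ m) (toℚᵘ-ℕ→ℚ n) ⟩
  ℚᵘ.mkℚᵘ (ℤ.+ m) 0 ℚᵘ.+ ℚᵘ.mkℚᵘ (ℤ.+ n) 0   ≈⟨ ℚᵘ.*≡* (cong (ℤ._* ℤ.+ 1) numerator) ⟩
  ℚᵘ.mkℚᵘ (ℤ.+ (m + n)) 0                  ≈⟨ toℚᵘ-ℕ→ℚ (m + n) ⟨
  toℚᵘ (ℕ→ℚ (m + n))                     ∎)
  where
  open ℚᵘ.≃-Reasoning
  numerator : ℤ.+ m ℤ.* ℤ.+ 1 ℤ.+ ℤ.+ n ℤ.* ℤ.+ 1 ≡ ℤ.+ (m + n)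
  numerator = cong₂ ℤ._+_ (ℤ.*-identityʳ (ℤ.+ m)) (ℤ.*-identityʳ (ℤ.+ n))

ℕ→ℚ-* : ∀ m n → ℕ→ℚ m ℚ.* ℕ→ℚ n ≡ ℕ→ℚ (m * n)
ℕ→ℚ-* m n = ℚ.toℚᵘ-injective (begin
  toℚᵘ (ℕ→ℚ m ℚ.* ℕ→ℚ n)                ≈⟨ ℚ.toℚᵘ-homo-* (ℕ→ℚ m) (ℕ→ℚ n) ⟩
  toℚᵘ (ℕ→ℚ m) ℚᵘ.* toℚᵘ (ℕ→ℚ n)       ≈⟨ ℚᵘ.*-cong (toℚᵘ-ℕ→ℚ m) (toℚᵘ-ℕ→ℚ n) ⟩
  ℚᵘ.mkℚᵘ (ℤ.+ m) 0 ℚᵘ.* ℚᵘ.mkℚᵘ (ℤ.+ n) 0   ≈⟨ ℚᵘ.*≡* (cong (ℤ._* ℤ.+ 1) (ℤ.pos-* m n)) ⟨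
  ℚᵘ.mkℚᵘ (ℤ.+ (m * n)) 0                  ≈⟨ toℚᵘ-ℕ→ℚ (m * n) ⟨
  toℚᵘ (ℕ→ℚ (m * n))                     ∎)
  where open ℚᵘ.≃-Reasoning

ℕ→ℚ-injective : ∀ {m n} → ℕ→ℚ m ≡ ℕ→ℚ n → m ≡ n
ℕ→ℚ-injective {m} {n} eq with ℚᵘ.≃-trans (ℚᵘ.≃-sym (toℚᵘ-ℕ→ℚ m)) (ℚᵘ.≃-trans (ℚ.toℚᵘ-cong eq) (toℚᵘ-ℕ→ℚ n))
... | ℚᵘ.*≡* e = ℤ.+-injective (trans (sym (ℤ.*-identityʳ (ℤ.+ m))) (trans e (ℤ.*-identityʳ (ℤ.+ n))))

ℕ→ℚ-difference≡0⇔ : ∀ m n → (ℕ→ℚ m ℚ.+ ℚ.- ℕ→ℚ n ≡ 0ℚ) ⇔ (m ≡ n)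
ℕ→ℚ-difference≡0⇔ m n = mk⇔ (λ e → ℕ→ℚ-injective (x∙y⁻¹≈ε⇒x≈y (ℕ→ℚ m) (ℕ→ℚ n) e))
                            (λ m≡n → x≈y⇒x∙y⁻¹≈ε (cong ℕ→ℚ m≡n))

P-coefficient : ∀ e F x s → F x ≡ ℕ→ℚ s → P e F x ≡ ℕ→ℚ (φ (x ^ e) * s)
P-coefficient e F x s Fx≡s = begin
  P e F x
    ≡⟨ cong (λ z → ℕ→ℚ c ℚ.* z ℚ.+ (ℕ→ℚ b ℚ.* z ℚ.+ (ℕ→ℚ a ℚ.* z ℚ.+ z))) Fx≡s ⟩
  ℕ→ℚ c ℚ.* ℕ→ℚ s ℚ.+ (ℕ→ℚ b ℚ.* ℕ→ℚ s ℚ.+ (ℕ→ℚ a ℚ.* ℕ→ℚ s ℚ.+ ℕ→ℚ s))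
    ≡⟨ cong₂ ℚ._+_ (ℕ→ℚ-* c s) (cong₂ ℚ._+_ (ℕ→ℚ-* b s) (cong (ℚ._+ ℕ→ℚ s) (ℕ→ℚ-* a s))) ⟩
  ℕ→ℚ (c * s) ℚ.+ (ℕ→ℚ (b * s) ℚ.+ (ℕ→ℚ (a * s) ℚ.+ ℕ→ℚ s))
    ≡⟨ cong (λ z → ℕ→ℚ (c * s) ℚ.+ (ℕ→ℚ (b * s) ℚ.+ z)) (ℕ→ℚ-+ (a * s) s) ⟩
  ℕ→ℚ (c * s) ℚ.+ (ℕ→ℚ (b * s) ℚ.+ ℕ→ℚ (a * s + s))
    ≡⟨ cong (ℕ→ℚ (c * s) ℚ.+_) (ℕ→ℚ-+ (b * s) (a * s + s)) ⟩
  ℕ→ℚ (c * s) ℚ.+ ℕ→ℚ (b * s + (a * s + s))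
    ≡⟨ ℕ→ℚ-+ (c * s) (b * s + (a * s + s)) ⟩
  ℕ→ℚ (c * s + (b * s + (a * s + s)))
    ≡⟨ cong₂ (λ u v → ℕ→ℚ (u * s + (v * s + (a * s + s)))) (^-cube x e) (^-square x e) ⟩
  ℕ→ℚ (a * a * a * s + (a * a * s + (a * s + s)))
    ≡⟨ cong ℕ→ℚ (eq a s) ⟩
  ℕ→ℚ (φ a * s) ∎
  where
  open ≡-Reasoning
  a = x ^ e
  b = x ^ (2 * e)
  c = x ^ (3 * e)
  eq : ∀ a s → a * a * a * s + (a * a * s + (a * s + s)) ≡ (a * a * a + (a * a + (a + 1))) * s
  eq = solve-∀

G-coefficient : ∀ s m → G (s + 1) (suc m) ≡ ℕ→ℚ (σ s (suc m))
G-coefficient s m rewrite +-comm s 1 = refl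

g≡0⇔ : ∀ k ℓ {n} → 1 ≤ n → (g k ℓ n ≡ 0ℚ) ⇔ (φ (n ^ ℓ) * σ (3 * k) n ≡ φ (n ^ k) * σ (3 * ℓ) n)
g≡0⇔ k ℓ {suc m} _ = subst (λ z → (z ≡ 0ℚ) ⇔ (X ≡ Y)) (sym g-coefficient) (ℕ→ℚ-difference≡0⇔ X Y)
  where
  n = suc m
  X = φ (n ^ ℓ) * σ (3 * k) n
  Y = φ (n ^ k) * σ (3 * ℓ) n
  g-coefficient : g k ℓ n ≡ ℕ→ℚ X ℚ.+ ℚ.- ℕ→ℚ Y
  g-coefficient = cong₂ (λ u v → u ℚ.+ ℚ.- v) (P-coefficient ℓ (G (3 * k + 1)) n _ (G-coefficient (3 * k) m))
                                              (P-coefficient k (G (3 * ℓ + 1)) n _ (G-coefficient (3 * ℓ) m))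

-- The sign of the coefficients

outer-sum : ∀ n e xs → sum (map (_^ (3 * e)) (1 ∷ xs ++ [ n ])) ≡ 1 + (sum (map (_^ (3 * e)) xs) + n ^ e * n ^ e * n ^ e)
outer-sum n e xs = begin
  1 ^ (3 * e) + sum (map (_^ (3 * e)) (xs ++ [ n ]))      ≡⟨ cong₂ _+_ (^-zeroˡ (3 * e)) (cong sum (map-++ (_^ (3 * e)) xs [ n ])) ⟩
  1 + sum (map (_^ (3 * e)) xs ++ [ n ^ (3 * e) ])        ≡⟨ cong (1 +_) (sum-++ (map (_^ (3 * e)) xs) [ n ^ (3 * e) ]) ⟩
  1 + (sum (map (_^ (3 * e)) xs) + (n ^ (3 * e) + 0))     ≡⟨ cong (λ z → 1 + (sum (map (_^ (3 * e)) xs) + z)) (trans (+-identityʳ _) (^-cube n e)) ⟩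
  1 + (sum (map (_^ (3 * e)) xs) + n ^ e * n ^ e * n ^ e) ∎
  where open ≡-Reasoning

prime-case : ∀ {n k ℓ} → Prime n → k < ℓ → φ (n ^ ℓ) * σ (3 * k) n < φ (n ^ k) * σ (3 * ℓ) n
prime-case {n} {k} {ℓ} pn k<ℓ = subst₂ _<_ (cong (φ A *_) (sym (σ-prime k))) (cong (φ a *_) (sym (σ-prime ℓ)))
  (φ-outer-cancel {A} {a} {0} {0}
    (subst₂ _<_ (cong (_+ φ a * (A + A * A)) (sym (*-zeroʳ (φ A)))) (cong (_+ φ A * (a + a * a)) (sym (*-zeroʳ (φ a))))
      (φ-middle-anti (m^n>0 n {{>-nonZero (<-trans (s≤s z≤n) 1<n)}} k) (^-monoʳ-< n 1<n k<ℓ))))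
  where
  instance _ = >-nonZero (<-trans (s≤s z≤n) (prime>1 pn))
  a = n ^ k
  A = n ^ ℓ
  1<n = prime>1 pn
  complete : ∀ {d} → d ∣ n → d ∈ 1 ∷ n ∷ []
  complete d∣n with prime⇒irreducible pn d∣n
  ... | inj₁ d≡1 = here d≡1
  ... | inj₂ d≡n = there (here d≡n)
  σ-prime : ∀ e → σ (3 * e) n ≡ 1 + (0 + n ^ e * n ^ e * n ^ e)
  σ-prime e = trans (σ-divisors (3 * e) (1<n ∷ [-]) (1∣ n ∷ ∣-refl ∷ []) complete) (outer-sum n e [])

σ-cube-of-prime : ∀ {p} e → Prime p → σ (3 * e) (p ^ 3) ≡ φ ((p ^ 3) ^ e)
σ-cube-of-prime {p} e pp = begin
  σ (3 * e) (p ^ 3)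
    ≡⟨ σ-divisors (3 * e) increasing (1∣ (p ^ 3) ∷ ^-∣ p {1} {3} (s≤s z≤n) ∷ ^-∣ p {2} {3} (s≤s (s≤s z≤n)) ∷ ∣-refl ∷ []) complete ⟩
  (p ^ 0) ^ (3 * e) + ((p ^ 1) ^ (3 * e) + ((p ^ 2) ^ (3 * e) + ((p ^ 3) ^ (3 * e) + 0)))
    ≡⟨ cong₂ _+_ (swap 0) (cong₂ _+_ (swap 1) (cong₂ _+_ (swap 2) (cong (_+ 0) (swap 3)))) ⟩
  N ^ 0 + (N ^ 1 + (N ^ 2 + (N ^ 3 + 0)))
    ≡⟨ eq N ⟩
  φ N ∎
  where
  open ≡-Reasoning
  instance _ = >-nonZero (m^n>0 p {{>-nonZero (<-trans (s≤s z≤n) (prime>1 pp))}} 3)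
  N = (p ^ 3) ^ e
  1<p = prime>1 pp
  increasing : Linked _<_ (p ^ 0 ∷ p ^ 1 ∷ p ^ 2 ∷ p ^ 3 ∷ [])
  increasing = ^-monoʳ-< p 1<p {0} {1} (s≤s z≤n) ∷ ^-monoʳ-< p 1<p {1} {2} (s≤s (s≤s z≤n))
             ∷ ^-monoʳ-< p 1<p {2} {3} (s≤s (s≤s (s≤s z≤n))) ∷ [-]
  complete : ∀ {d} → d ∣ p ^ 3 → d ∈ p ^ 0 ∷ p ^ 1 ∷ p ^ 2 ∷ p ^ 3 ∷ []
  complete d∣p³ with prime-power-divisor 3 pp d∣p³
  ... | 0 , _ , d≡ = here d≡
  ... | 1 , _ , d≡ = there (here d≡)
  ... | 2 , _ , d≡ = there (there (here d≡))
  ... | 3 , _ , d≡ = there (there (there (here d≡)))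
  ... | suc (suc (suc (suc _))) , s≤s (s≤s (s≤s ())) , _
  swap : ∀ i → (p ^ i) ^ (3 * e) ≡ N ^ i
  swap i = begin
    (p ^ i) ^ (3 * e)  ≡⟨ ^-*-assoc p i (3 * e) ⟩
    p ^ (i * (3 * e))  ≡⟨ cong (p ^_) (ee i e) ⟩
    p ^ (3 * (e * i))  ≡⟨ ^-*-assoc p 3 (e * i) ⟨
    (p ^ 3) ^ (e * i)  ≡⟨ ^-*-assoc (p ^ 3) e i ⟨
    N ^ i              ∎
    where
    ee : ∀ i e → i * (3 * e) ≡ 3 * (e * i)
    ee = solve-∀
  eq : ∀ N → 1 + (N * 1 + (N * (N * 1) + (N * (N * (N * 1)) + 0))) ≡ N * N * N + (N * N + (N + 1))
  eq = solve-∀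

cube-case : ∀ {n p k ℓ} → Prime p → n ≡ p ^ 3 → φ (n ^ ℓ) * σ (3 * k) n ≡ φ (n ^ k) * σ (3 * ℓ) n
cube-case {_} {p} {k} {ℓ} pp refl = begin
  φ (n ^ ℓ) * σ (3 * k) n ≡⟨ cong (φ (n ^ ℓ) *_) (σ-cube-of-prime k pp) ⟩
  φ (n ^ ℓ) * φ (n ^ k)   ≡⟨ *-comm (φ (n ^ ℓ)) (φ (n ^ k)) ⟩
  φ (n ^ k) * φ (n ^ ℓ)   ≡⟨ cong (φ (n ^ k) *_) (σ-cube-of-prime ℓ pp) ⟨
  φ (n ^ k) * σ (3 * ℓ) n ∎
  where
  open ≡-Reasoning
  n = p ^ 3

pair-sum : ∀ p q e → sum (map (_^ (3 * e)) (p ∷ q ∷ [])) ≡ (p ^ 3) ^ e + (q ^ 3) ^ e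
pair-sum p q e = cong₂ _+_ (cube-power p e) (trans (+-identityʳ _) (cube-power q e))

semiprime-case : ∀ {n p q k j} → Prime p → Prime q → p < q → n ≡ p * q → n < p ^ 3 → 1 ≤ k → 2 ≤ j →
  φ (n ^ (k + j)) * σ (3 * k) n < φ (n ^ k) * σ (3 * (k + j)) n
semiprime-case {_} {p} {q} {k} {j} pp pq p<q refl n<p³ 1≤k 2≤j =
  subst₂ _<_ (cong (φ A *_) (sym (σ-semiprime k))) (cong (φ a *_) (sym (σ-semiprime (k + j))))
    (φ-outer-cancel {A} {a} (deficit-decreasing 1≤k 2≤j 4≤n n<p³ (^-monoˡ-≤ 3 (<⇒≤ p<q)) (cube-product {p = p} {q} refl)))
  where
  n = p * q
  a = n ^ k
  A = n ^ (k + j)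
  2≤p = prime>1 pp
  2≤q = prime>1 pq
  4≤n : 4 ≤ n
  4≤n = *-mono-≤ 2≤p 2≤q
  instance _ = >-nonZero (≤-trans (s≤s z≤n) 4≤n)
  complete : ∀ {d} → d ∣ n → d ∈ 1 ∷ p ∷ q ∷ n ∷ []
  complete d∣n with prime-product-divisor pp pq d∣n
  ... | inj₁ d≡1 = here d≡1
  ... | inj₂ (inj₁ d≡p) = there (here d≡p)
  ... | inj₂ (inj₂ (inj₁ d≡q)) = there (there (here d≡q))
  ... | inj₂ (inj₂ (inj₂ d≡n)) = there (there (there (here d≡n)))
  σ-semiprime : ∀ e → σ (3 * e) n ≡ 1 + ((p ^ 3) ^ e + (q ^ 3) ^ e + n ^ e * n ^ e * n ^ e)
  σ-semiprime e = begin
    σ (3 * e) n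
      ≡⟨ σ-divisors (3 * e) (2≤p ∷ p<q ∷ subst (q <_) (*-comm q p) (m<m*n q p {{>-nonZero (<-trans (s≤s z≤n) 2≤q)}} 2≤p) ∷ [-])
                            (1∣ n ∷ m∣m*n q ∷ n∣m*n p ∷ ∣-refl ∷ []) complete ⟩
    sum (map (_^ (3 * e)) (1 ∷ (p ∷ q ∷ []) ++ [ n ]))
      ≡⟨ outer-sum n e (p ∷ q ∷ []) ⟩
    1 + (sum (map (_^ (3 * e)) (p ∷ q ∷ [])) + n ^ e * n ^ e * n ^ e)
      ≡⟨ cong (λ z → 1 + (z + n ^ e * n ^ e * n ^ e)) (pair-sum p q e) ⟩
    1 + ((p ^ 3) ^ e + (q ^ 3) ^ e + n ^ e * n ^ e * n ^ e) ∎
    where open ≡-Reasoning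

square-case : ∀ {n p k j} → Prime p → n ≡ p * p → 1 ≤ k → 2 ≤ j →
  φ (n ^ (k + j)) * σ (3 * k) n < φ (n ^ k) * σ (3 * (k + j)) n
square-case {_} {p} {k} {j} pp refl 1≤k 2≤j =
  subst₂ _<_ (cong (φ A *_) (sym (σ-square k))) (cong (φ a *_) (sym (σ-square (k + j))))
    (φ-outer-cancel {A} {a} (double-cancel-< middle-term
      (subst₂ _<_ (e (φ A) (u ^ k) (φ a * (A + A * A))) (e (φ a) (u ^ (k + j)) (φ A * (a + a * a)))
        (deficit-decreasing 1≤k 2≤j 4≤n n<u ≤-refl (cube-product {p = p} {p} refl)))))
  where
  n = p * p
  a = n ^ k
  A = n ^ (k + j)
  u = p ^ 3
  2≤p = prime>1 pp
  4≤n : 4 ≤ n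
  4≤n = *-mono-≤ 2≤p 2≤p
  instance _ = >-nonZero (≤-trans (s≤s z≤n) 4≤n)
  n<u : n < u
  n<u = subst (_< u) (cong (p *_) (*-identityʳ p)) (^-monoʳ-< p 2≤p {2} {3} (s≤s (s≤s (s≤s z≤n))))
  e : ∀ c b P → c * (b + b) + P ≡ c * b + (c * b + P)
  e = solve-∀
  middle-term : φ a * u ^ (k + j) ≤ φ A * u ^ k
  middle-term = proper-term-≤ 1≤k (≤-trans (s≤s z≤n) 2≤j) (≤-trans (s≤s (s≤s z≤n)) 4≤n)
    (≤-trans (*-monoˡ-≤ u (^-monoˡ-≤ 3 2≤p)) (≤-reflexive (cube-product {p = p} {p} refl)))
  complete : ∀ {d} → d ∣ n → d ∈ 1 ∷ p ∷ n ∷ []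
  complete {d} d∣n with prime-power-divisor 2 pp (subst (d ∣_) (cong (p *_) (sym (*-identityʳ p))) d∣n)
  ... | 0 , _ , d≡1 = here d≡1
  ... | 1 , _ , d≡p = there (here (trans d≡p (*-identityʳ p)))
  ... | 2 , _ , d≡n = there (there (here (trans d≡n (cong (p *_) (*-identityʳ p)))))
  ... | suc (suc (suc _)) , s≤s (s≤s ()) , _
  σ-square : ∀ e → σ (3 * e) n ≡ 1 + ((p ^ 3) ^ e + n ^ e * n ^ e * n ^ e)
  σ-square e = begin
    σ (3 * e) n
      ≡⟨ σ-divisors (3 * e) (2≤p ∷ m<m*n p p {{>-nonZero (<-trans (s≤s z≤n) 2≤p)}} 2≤p ∷ [-])
                            (1∣ n ∷ m∣m*n p ∷ ∣-refl ∷ []) complete ⟩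
    sum (map (_^ (3 * e)) (1 ∷ (p ∷ []) ++ [ n ]))
      ≡⟨ outer-sum n e (p ∷ []) ⟩
    1 + (p ^ (3 * e) + 0 + n ^ e * n ^ e * n ^ e)
      ≡⟨ cong (λ z → 1 + (z + n ^ e * n ^ e * n ^ e)) (trans (+-identityʳ _) (cube-power p e)) ⟩
    1 + ((p ^ 3) ^ e + n ^ e * n ^ e * n ^ e) ∎
    where open ≡-Reasoning

small-divisor-case : ∀ {n p k j} → 2 ≤ p → p ∣ n → p ^ 3 < n → 1 ≤ k → 2 ≤ j →
  φ (n ^ k) * σ (3 * (k + j)) n < φ (n ^ (k + j)) * σ (3 * k) n
small-divisor-case {_} {p} {k} {j} 2≤p (divides m refl) p³<n 1≤k 2≤j =
  σ-cross-< {c = φ a} {φ A} {3 * (k + j)} {3 * k} (2≤p ∷ p<m ∷ m<n ∷ [-]) (1∣ n ∷ n∣m*n m ∷ m∣m*n p ∷ ∣-refl ∷ [])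
    (subst₂ _<_ (cong (φ a *_) (sym (listed-sum (k + j)))) (cong (φ A *_) (sym (listed-sum k)))
      (φ-outer-cancel {a} {A} (excess-decreasing 1≤k 2≤j (^-monoˡ-≤ 3 2≤p) p³<n (cube-product {p = p} {m} (*-comm m p)))))
    others
  where
  n = m * p
  a = n ^ k
  A = n ^ (k + j)
  0<p : 0 < p
  0<p = ≤-trans (s≤s z≤n) 2≤p
  pp<m : p * p < m
  pp<m = *-cancelʳ-< p (p * p) m (subst (_< n) (^-3≡ p) p³<n)
  p<m : p < m
  p<m = ≤-<-trans (m≤m*n p p {{>-nonZero 0<p}}) pp<m
  m<n : m < n
  m<n = m<m*n m p {{>-nonZero (<-trans 0<p p<m)}} 2≤p
  0<n : 0 < n
  0<n = <-trans (<-trans 0<p p<m) m<n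
  instance _ = >-nonZero 0<n
  listed-sum : ∀ e → sum (map (_^ (3 * e)) (1 ∷ (p ∷ m ∷ []) ++ [ n ])) ≡ 1 + ((p ^ 3) ^ e + (m ^ 3) ^ e + n ^ e * n ^ e * n ^ e)
  listed-sum e = trans (outer-sum n e (p ∷ m ∷ [])) (cong (λ z → 1 + (z + n ^ e * n ^ e * n ^ e)) (pair-sum p m e))
  others : ∀ {d} → d ∣ n → d ∉ 1 ∷ p ∷ m ∷ n ∷ [] → φ a * d ^ (3 * (k + j)) ≤ φ A * d ^ (3 * k)
  others {d} d∣n d∉ = subst₂ _≤_ (cong (φ a *_) (sym (cube-power d (k + j)))) (cong (φ A *_) (sym (cube-power d k)))
    (proper-term-≤ 1≤k (≤-trans (s≤s z≤n) 2≤j) (≤-trans 2≤p (<⇒≤ (<-trans p<m m<n)))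
      (subst₂ _≤_ (e d) (^-3≡ n) (^-monoˡ-≤ 3 (proper-divisor-double d∣n 0<n λ d≡n → d∉ (there (there (there (here d≡n))))))))
    where
    e : ∀ d → 2 * d * (2 * d * (2 * d * 1)) ≡ 8 * (d * (d * (d * 1)))
    e = solve-∀

large-least-factor-case : ∀ {n p k j} → 2 ≤ n → 2 ≤ p → p ∣ n → p Rough n → n < p ^ 3 → 1 ≤ k → 2 ≤ j →
  φ (n ^ (k + j)) * σ (3 * k) n < φ (n ^ k) * σ (3 * (k + j)) n
large-least-factor-case 2≤n _ (divides zero refl) _ _ _ _ = contradiction 2≤n λ ()
large-least-factor-case {p = p} {k} {j} _ 2≤p p∣n@(divides 1 refl) r _ _ 2≤j =
  prime-case (subst Prime (sym (+-identityʳ p)) (rough∧∣⇒prime {{n>1⇒nonTrivial 2≤p}} r p∣n)) (m<m+n k (≤-trans (s≤s z≤n) 2≤j))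
large-least-factor-case {p = p} 2≤n 2≤p (divides m@(suc (suc _)) refl) r n<p³ 1≤k 2≤j with m≤n⇒m<n∨m≡n p≤m
  where
  p≤m : p ≤ m
  p≤m = rough⇒≤ (rough∧∣⇒rough r (m∣m*n p))
... | inj₁ p<m = semiprime-case pp (cofactor-prime r (*-comm m p) (s≤s (s≤s z≤n)) m<pp) p<m (*-comm m p) n<p³ 1≤k 2≤j
  where
  pp = rough∧∣⇒prime {{n>1⇒nonTrivial 2≤p}} r (n∣m*n m)
  m<pp : m < p * p
  m<pp = *-cancelʳ-< p m (p * p) (subst (m * p <_) (^-3≡ p) n<p³)
... | inj₂ refl = square-case (rough∧∣⇒prime {{n>1⇒nonTrivial 2≤p}} r (n∣m*n m)) refl 1≤k 2≤j

cross-equal⇔cube : ∀ {n k j} → 2 ≤ n → 1 ≤ k → 2 ≤ j →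
  (φ (n ^ (k + j)) * σ (3 * k) n ≡ φ (n ^ k) * σ (3 * (k + j)) n) ⇔ (∃ λ p → Prime p × n ≡ p ^ 3)
cross-equal⇔cube {n} {k} {j} 2≤n 1≤k 2≤j with least-factor 2≤n
... | p , 2≤p , p∣n , r = mk⇔ to from
  where
  to : φ (n ^ (k + j)) * σ (3 * k) n ≡ φ (n ^ k) * σ (3 * (k + j)) n → ∃ λ p → Prime p × n ≡ p ^ 3
  to X≡Y with <-cmp (p ^ 3) n
  ... | tri< p³<n _ _ = contradiction (sym X≡Y) (<⇒≢ (small-divisor-case 2≤p p∣n p³<n 1≤k 2≤j))
  ... | tri≈ _ p³≡n _ = p , rough∧∣⇒prime {{n>1⇒nonTrivial 2≤p}} r p∣n , sym p³≡n
  ... | tri> _ _ n<p³ = contradiction X≡Y (<⇒≢ (large-least-factor-case 2≤n 2≤p p∣n r n<p³ 1≤k 2≤j))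
  from : (∃ λ p → Prime p × n ≡ p ^ 3) → φ (n ^ (k + j)) * σ (3 * k) n ≡ φ (n ^ k) * σ (3 * (k + j)) n
  from (q , pq , n≡q³) = cube-case {k = k} {k + j} pq n≡q³

odd-positive : ∀ {k} → Odd k → 1 ≤ k
odd-positive (_ , refl) = s≤s z≤n

odd-gap : ∀ {k ℓ} → Odd k → Odd ℓ → k < ℓ → ∃ λ j → 2 ≤ j × ℓ ≡ k + j
odd-gap (a , refl) (b , refl) k<ℓ with m≤n⇒∃[o]m+o≡n (*-cancelˡ-< 2 a b (≤-pred k<ℓ))
... | t , refl = 2 + 2 * t , s≤s (s≤s z≤n) , e a t
  where
  e : ∀ a t → suc (2 * (suc a + t)) ≡ suc (2 * a) + (2 + 2 * t)
  e = solve-∀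

theorem3p1 : (k ℓ : ℕ) → Odd k → Odd ℓ → k < ℓ →
    (n : ℕ) → 2 ≤ n →
      (g k ℓ n ≡ 0ℚ) ⇔ (∃ λ p → Prime p × n ≡ p ^ 3)
theorem3p1 k ℓ odd-k odd-ℓ k<ℓ n 2≤n with odd-gap odd-k odd-ℓ k<ℓ
... | j , 2≤j , refl = cross-equal⇔cube 2≤n (odd-positive odd-k) 2≤j ⇔-∘ g≡0⇔ k (k + j) (≤-trans (s≤s z≤n) 2≤n)
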